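{- Let $G$ be a connected graph on $n \geq 3$ vertices with constant resistance curvature. Then $G$ is 2-connected.
   Context: All graphs are finite, simple and undirected. For a connected graph $G$ and vertices $i,j$, the resistance distance $\Omega_G(i,j)$ is the effective resistance between $i$ and $j$ in the electrical network obtained from $G$ by replacing each edge with a unit resistor. The resistance matrix $R_G$ is the $n\times n$ matrix with $(i,j)$-entry $\Omega_G(i,j)$; it is nonsingular. The resistance curvature vector $\kappa=(\kappa_1,\dots,\kappa_n)^T$ is the unique solution of $R_G\kappa=\mathbf{1}$, where $\mathbf{1}$ is the all-ones vector; $\kappa_i$ is the resistance curvature at vertex $v_i$. $G$ has constant resistance curvature if all $\kappa_i$ are equal. A graph is 2-connected if it is connected, has at least three vertices, and has no cut vertex (a vertex whose deletion disconnects the graph). -}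

module Defs where

open import Data.Nat using (ℕ; zero; suc)
open import Data.Fin using (Fin; zero; suc; _≟_)
open import Data.Bool using (Bool; true; false; if_then_else_)
open import Data.Rational using (ℚ; 0ℚ; 1ℚ; _+_; _-_; _*_)
open import Data.Product using (Σ; _×_; ∃)
open import Relation.Nullary.Decidable using (⌊_⌋)
open import Relation.Nullary using (¬_)
open import Relation.Binary.PropositionalEquality using (_≡_)

record Graph (n : ℕ) : Set where
  field
    adj    : Fin n → Fin n → Bool
    sym    : ∀ i j → adj i j ≡ adj j i
    irrefl : ∀ i → adj i i ≡ false
open Graph public

data WalkIn {n : ℕ} (G : Graph n) (P : Fin n → Set) : Fin n → Fin n → Set where
  here : ∀ {a} → P a → WalkIn G P a a
  step : ∀ {a b c} → P a → adj G a b ≡ true → WalkIn G P b c → WalkIn G P a c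

Everywhere : {n : ℕ} → Fin n → Set
Everywhere _ = Data.Unit.⊤
  where import Data.Unit

Connected : {n : ℕ} → Graph n → Set
Connected {n} G = ∀ (a b : Fin n) → WalkIn G Everywhere a b

ConnectedWithout : {n : ℕ} → Graph n → Fin n → Set
ConnectedWithout {n} G v =
  ∀ (a b : Fin n) → ¬ (a ≡ v) → ¬ (b ≡ v) → WalkIn G (λ u → ¬ (u ≡ v)) a b

IsCutVertex : {n : ℕ} → Graph n → Fin n → Set
IsCutVertex G v = ¬ ConnectedWithout G v

TwoConnected : {n : ℕ} → Graph n → Set
TwoConnected {n} G = Connected G × (3 Data.Nat.≤ n) × (∀ v → ¬ IsCutVertex G v)
  where import Data.Nat

sumFin : ∀ {n} → (Fin n → ℚ) → ℚ
sumFin {zero}  f = 0ℚ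
sumFin {suc n} f = f zero + sumFin (λ k → f (suc k))

laplacian : ∀ {n} → Graph n → (Fin n → ℚ) → Fin n → ℚ
laplacian G x i = sumFin (λ j → if adj G i j then x i - x j else 0ℚ)

indicator : ∀ {n} → Fin n → Fin n → ℚ
indicator i k = if ⌊ k ≟ i ⌋ then 1ℚ else 0ℚ

-- Effective resistance between i and j with unit resistors: inject unit current at i,
-- extract it at j; by Kirchhoff/Ohm the potentials x satisfy L x = e_i - e_j, and the
-- resistance is the potential difference x_i - x_j.
IsResistanceDistance : ∀ {n} → Graph n → Fin n → Fin n → ℚ → Set
IsResistanceDistance {n} G i j r =
  Σ (Fin n → ℚ) (λ x →
    (∀ k → laplacian G x k ≡ indicator i k - indicator j k) × (x i - x j ≡ r))

-- Constant curvature κ makes all row sums ρᵢ = ∑ⱼ Ω(i,j) equal, because ρᵢ κ = 1.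
-- Suppose v splits G − v into sides A and B. Resistances add in series across v, so for i ∈ A
-- the equation ρᵢ = ρᵥ reads ∑_{j∈A} Ω(i,j) + (1 + |B|) Ω(i,v) = ∑_{j∈A} Ω(v,j). Summing over
-- i ∈ A and using symmetry gives T + (1 + |B|) s = |A| s with T ≥ 0 and s = ∑_{j∈A} Ω(v,j) > 0,
-- hence |A| > |B|; by symmetry also |B| > |A|. Positivity, symmetry, uniqueness and the series law
-- for resistances all come from the Dirichlet energy x·Lx = ½ ∑_{k~m} (x_k − x_m)², which on a
-- connected graph vanishes only on constant potentials.

module Submission where

open import Defs
open import Data.Nat using (ℕ; _≤_)
open import Data.Fin using (Fin)
open import Data.Rational using (ℚ; 1ℚ; _*_)
open import Relation.Binary.PropositionalEquality using (_≡_)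

open import Algebra.Bundles using (CommutativeRing)
open import Data.Nat using (zero; suc)
open import Data.Fin using (zero; suc; _≟_)
open import Data.Bool using (Bool; true; false; if_then_else_)
open import Data.Rational using (0ℚ; _+_; _-_; -_; 1/_; ≢-nonZero; nonNegative; nonPositive)
  renaming (_≤_ to _≤ℚ_)
import Data.Rational.Properties as ℚ
open import Data.Rational.Solver using (module +-*-Solver)
open import Data.Product using (_×_; _,_; proj₁)
open import Data.Sum using (_⊎_; inj₁; inj₂)
open import Data.Empty using (⊥; ⊥-elim)
open import Relation.Nullary using (¬_; Dec; yes; no; ¬?; _×-dec_)
open import Relation.Nullary.Decidable using (decidable-stable; ¬¬-excluded-middle)
open import Relation.Unary using (Decidable)
import Relation.Binary.PropositionalEquality as ≡
open ≡ using (refl; trans; cong; cong₂; subst; module ≡-Reasoning)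

open import Algebra.Properties.Semiring.Sum (CommutativeRing.semiring ℚ.+-*-commutativeRing)
  using (sum; ∑-distrib-+; ∑-comm; *-distribˡ-sum)
open import Algebra.Properties.Ring (CommutativeRing.ring ℚ.+-*-commutativeRing)
  using (-1*x≈-x)
open import Algebra.Properties.Group ℚ.+-0-group
  using (x∙y⁻¹≈ε⇒x≈y; ∙-cancelʳ)
open import Function using (_∘_)
open +-*-Solver

private
  variable
    n : ℕ

sumFin≡sum : (f : Fin n → ℚ) → sumFin f ≡ sum f
sumFin≡sum {zero}  f = refl
sumFin≡sum {suc n} f = cong (f zero +_) (sumFin≡sum (λ k → f (suc k)))

sumFin-cong : {f g : Fin n → ℚ} → (∀ k → f k ≡ g k) → sumFin f ≡ sumFin g
sumFin-cong {zero}  f≗g = refl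
sumFin-cong {suc n} f≗g = cong₂ _+_ (f≗g zero) (sumFin-cong (λ k → f≗g (suc k)))

sumFin-zero : {f : Fin n → ℚ} → (∀ k → f k ≡ 0ℚ) → sumFin f ≡ 0ℚ
sumFin-zero {zero}  f≗0 = refl
sumFin-zero {suc n} f≗0 = cong₂ _+_ (f≗0 zero) (sumFin-zero (λ k → f≗0 (suc k)))

sumFin-+ : (f g : Fin n → ℚ) → sumFin (λ k → f k + g k) ≡ sumFin f + sumFin g
sumFin-+ f g = begin
  sumFin (λ k → f k + g k)  ≡⟨ sumFin≡sum (λ k → f k + g k) ⟩
  sum (λ k → f k + g k)     ≡⟨ ∑-distrib-+ f g ⟩
  sum f + sum g             ≡⟨ ≡.sym (cong₂ _+_ (sumFin≡sum f) (sumFin≡sum g)) ⟩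
  sumFin f + sumFin g       ∎
  where open ≡-Reasoning

sumFin-*ˡ : (c : ℚ) (f : Fin n → ℚ) → sumFin (λ k → c * f k) ≡ c * sumFin f
sumFin-*ˡ c f = begin
  sumFin (λ k → c * f k)  ≡⟨ sumFin≡sum (λ k → c * f k) ⟩
  sum (λ k → c * f k)     ≡⟨ ≡.sym (*-distribˡ-sum c f) ⟩
  c * sum f               ≡⟨ cong (c *_) (≡.sym (sumFin≡sum f)) ⟩
  c * sumFin f            ∎
  where open ≡-Reasoning

sumFin-*ʳ : (c : ℚ) (f : Fin n → ℚ) → sumFin (λ k → f k * c) ≡ sumFin f * c
sumFin-*ʳ c f = begin
  sumFin (λ k → f k * c)  ≡⟨ sumFin-cong (λ k → ℚ.*-comm (f k) c) ⟩
  sumFin (λ k → c * f k)  ≡⟨ sumFin-*ˡ c f ⟩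
  c * sumFin f            ≡⟨ ℚ.*-comm c _ ⟩
  sumFin f * c            ∎
  where open ≡-Reasoning

sumFin-neg : (f : Fin n → ℚ) → sumFin (λ k → - f k) ≡ - sumFin f
sumFin-neg f = begin
  sumFin (λ k → - f k)      ≡⟨ sumFin-cong (λ k → ≡.sym (-1*x≈-x (f k))) ⟩
  sumFin (λ k → - 1ℚ * f k) ≡⟨ sumFin-*ˡ (- 1ℚ) f ⟩
  - 1ℚ * sumFin f           ≡⟨ -1*x≈-x _ ⟩
  - sumFin f                ∎
  where open ≡-Reasoning

sumFin-- : (f g : Fin n → ℚ) → sumFin (λ k → f k - g k) ≡ sumFin f - sumFin g
sumFin-- f g = trans (sumFin-+ f (λ k → - g k)) (cong (sumFin f +_) (sumFin-neg g))

sumFin-comm : ∀ {m} (f : Fin n → Fin m → ℚ) →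
              sumFin (λ k → sumFin (f k)) ≡ sumFin (λ l → sumFin (λ k → f k l))
sumFin-comm f = trans (sumFin²≡sum² f) (trans (∑-comm f) (≡.sym (sumFin²≡sum² (λ l k → f k l))))
  where
  sumFin²≡sum² : ∀ {n m} (g : Fin n → Fin m → ℚ) → sumFin (λ k → sumFin (g k)) ≡ sum (λ k → sum (g k))
  sumFin²≡sum² g = trans (sumFin-cong (λ k → sumFin≡sum (g k))) (sumFin≡sum (λ k → sum (g k)))

sumFin-nonNeg : {f : Fin n → ℚ} → (∀ k → 0ℚ ≤ℚ f k) → 0ℚ ≤ℚ sumFin f
sumFin-nonNeg {zero}  0≤f = ℚ.≤-refl
sumFin-nonNeg {suc n} 0≤f = ℚ.+-mono-≤ (0≤f zero) (sumFin-nonNeg (λ k → 0≤f (suc k)))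

nonNeg+nonNeg≡0⇒≡0 : ∀ {p q} → 0ℚ ≤ℚ p → 0ℚ ≤ℚ q → p + q ≡ 0ℚ → p ≡ 0ℚ
nonNeg+nonNeg≡0⇒≡0 {p} {q} 0≤p 0≤q p+q≡0 = ℚ.≤-antisym p≤0 0≤p
  where
  open ℚ.≤-Reasoning
  p≤0 : p ≤ℚ 0ℚ
  p≤0 = begin
    p      ≡⟨ ≡.sym (ℚ.+-identityʳ p) ⟩
    p + 0ℚ ≤⟨ ℚ.+-monoʳ-≤ p 0≤q ⟩
    p + q  ≡⟨ p+q≡0 ⟩
    0ℚ     ∎

sumFin-nonNeg-≡0 : {f : Fin n → ℚ} → (∀ k → 0ℚ ≤ℚ f k) → sumFin f ≡ 0ℚ → ∀ k → f k ≡ 0ℚ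
sumFin-nonNeg-≡0 {suc n} {f} 0≤f Σf≡0 zero =
  nonNeg+nonNeg≡0⇒≡0 (0≤f zero) (sumFin-nonNeg (λ k → 0≤f (suc k))) Σf≡0
sumFin-nonNeg-≡0 {suc n} {f} 0≤f Σf≡0 (suc k) = sumFin-nonNeg-≡0 (λ k → 0≤f (suc k)) Σtail≡0 k
  where
  Σtail≡0 : sumFin (λ k → f (suc k)) ≡ 0ℚ
  Σtail≡0 = nonNeg+nonNeg≡0⇒≡0 (sumFin-nonNeg (λ k → 0≤f (suc k))) (0≤f zero)
              (trans (ℚ.+-comm _ (f zero)) Σf≡0)

indicator-diag : (i : Fin n) → indicator i i ≡ 1ℚ
indicator-diag i with i ≟ i
... | yes _   = refl
... | no i≢i = ⊥-elim (i≢i refl)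

indicator-off : {i k : Fin n} → ¬ k ≡ i → indicator i k ≡ 0ℚ
indicator-off {i = i} {k} k≢i with k ≟ i
... | yes k≡i = ⊥-elim (k≢i k≡i)
... | no _    = refl

indicator-suc : (i k : Fin n) → indicator (suc i) (suc k) ≡ indicator i k
indicator-suc i k with k ≟ i
... | yes _ = refl
... | no _  = refl

sumFin-indicator : (f : Fin n → ℚ) (i : Fin n) → sumFin (λ k → f k * indicator i k) ≡ f i
sumFin-indicator {suc n} f zero = begin
  f zero * 1ℚ + sumFin (λ k → f (suc k) * 0ℚ) ≡⟨ cong₂ _+_ (ℚ.*-identityʳ (f zero)) (sumFin-zero (λ k → ℚ.*-zeroʳ (f (suc k)))) ⟩
  f zero + 0ℚ                                  ≡⟨ ℚ.+-identityʳ (f zero) ⟩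
  f zero                                       ∎
  where open ≡-Reasoning
sumFin-indicator {suc n} f (suc i) = begin
  f zero * 0ℚ + sumFin (λ k → f (suc k) * indicator (suc i) (suc k))
    ≡⟨ cong₂ _+_ (ℚ.*-zeroʳ (f zero)) (sumFin-cong (λ k → cong (f (suc k) *_) (indicator-suc i k))) ⟩
  0ℚ + sumFin (λ k → f (suc k) * indicator i k)
    ≡⟨ trans (ℚ.+-identityˡ _) (sumFin-indicator (λ k → f (suc k)) i) ⟩
  f (suc i)
    ∎
  where open ≡-Reasoning

0≤p*p : ∀ p → 0ℚ ≤ℚ p * p
0≤p*p p with ℚ.≤-total 0ℚ p
... | inj₁ 0≤p = subst (_≤ℚ p * p) (ℚ.*-zeroˡ p) (ℚ.*-monoʳ-≤-nonNeg p {{nonNegative 0≤p}} 0≤p)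
... | inj₂ p≤0 = subst (_≤ℚ p * p) (ℚ.*-zeroˡ p) (ℚ.*-monoʳ-≤-nonPos p {{nonPositive p≤0}} p≤0)

p*p≡0⇒p≡0 : ∀ p → p * p ≡ 0ℚ → p ≡ 0ℚ
p*p≡0⇒p≡0 p p²≡0 with p ℚ.≟ 0ℚ
... | yes p≡0 = p≡0
... | no  p≢0 = begin
  p                  ≡⟨ ≡.sym (ℚ.*-identityʳ p) ⟩
  p * 1ℚ             ≡⟨ cong (p *_) (≡.sym (ℚ.*-inverseʳ p)) ⟩
  p * (p * 1/ p)     ≡⟨ ≡.sym (ℚ.*-assoc p p (1/ p)) ⟩
  (p * p) * 1/ p     ≡⟨ cong (_* 1/ p) p²≡0 ⟩
  0ℚ * 1/ p          ≡⟨ ℚ.*-zeroˡ (1/ p) ⟩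
  0ℚ                 ∎
  where
  open ≡-Reasoning
  instance _ = ≢-nonZero p≢0

0≤p+p⇒0≤p : ∀ p → 0ℚ ≤ℚ p + p → 0ℚ ≤ℚ p
0≤p+p⇒0≤p p 0≤2p with ℚ.≤-total 0ℚ p
... | inj₁ 0≤p = 0≤p
... | inj₂ p≤0 = ℚ.≤-trans 0≤2p (ℚ.≤-trans (ℚ.+-monoʳ-≤ p p≤0) (ℚ.≤-reflexive (ℚ.+-identityʳ p)))

module _ {G : Graph n} {P : Fin n → Set} where

  walk-end : ∀ {a b} → WalkIn G P a b → P b
  walk-end (here Pa)       = Pa
  walk-end (step _ _ walk) = walk-end walk

  walk-snoc : ∀ {a b c} → WalkIn G P a b → adj G b c ≡ true → P c → WalkIn G P a c
  walk-snoc (here Pa)          b~c Pc = step Pa b~c (here Pc)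
  walk-snoc (step Pa a~a′ walk) b~c Pc = step Pa a~a′ (walk-snoc walk b~c Pc)

  walk-preserves : ∀ {A : Set} (x : Fin n → A) → (∀ {k m} → adj G k m ≡ true → x k ≡ x m) →
                   ∀ {a b} → WalkIn G P a b → x a ≡ x b
  walk-preserves x x-edge (here _)         = refl
  walk-preserves x x-edge (step _ a~a′ walk) = trans (x-edge a~a′) (walk-preserves x x-edge walk)

module Dirichlet (G : Graph n) where

  laplacian-+ : (x y : Fin n → ℚ) (i : Fin n) →
                laplacian G (λ k → x k + y k) i ≡ laplacian G x i + laplacian G y i
  laplacian-+ x y i = trans (sumFin-cong term) (sumFin-+ {n} _ _)
    where
    term : ∀ j → (if adj G i j then (x i + y i) - (x j + y j) else 0ℚ)
               ≡ (if adj G i j then x i - x j else 0ℚ) + (if adj G i j then y i - y j else 0ℚ)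
    term j with adj G i j
    ... | true  = solve 4 (λ a b c d → (a :+ b) :- (c :+ d) := (a :- c) :+ (b :- d)) refl (x i) (y i) (x j) (y j)
    ... | false = refl

  laplacian-neg : (x : Fin n → ℚ) (i : Fin n) → laplacian G (λ k → - x k) i ≡ - laplacian G x i
  laplacian-neg x i = trans (sumFin-cong term) (sumFin-neg {n} _)
    where
    term : ∀ j → (if adj G i j then (- x i) - (- x j) else 0ℚ) ≡ - (if adj G i j then x i - x j else 0ℚ)
    term j with adj G i j
    ... | true  = solve 2 (λ a c → (:- a) :- (:- c) := :- (a :- c)) refl (x i) (x j)
    ... | false = refl

  laplacian-- : (x y : Fin n → ℚ) (i : Fin n) →
                laplacian G (λ k → x k - y k) i ≡ laplacian G x i - laplacian G y i
  laplacian-- x y i = trans (laplacian-+ x (λ k → - y k) i) (cong (laplacian G x i +_) (laplacian-neg y i))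

  energy : (Fin n → ℚ) → ℚ
  energy x = sumFin (λ k → x k * laplacian G x k)

  edgeSquare : (Fin n → ℚ) → Fin n → Fin n → ℚ
  edgeSquare x k m = if adj G k m then (x k - x m) * (x k - x m) else 0ℚ

  energy+energy≡sum-edgeSquare : (x : Fin n → ℚ) →
    energy x + energy x ≡ sumFin (λ k → sumFin (λ m → edgeSquare x k m))
  energy+energy≡sum-edgeSquare x = begin
    energy x + energy x
      ≡⟨ cong₂ _+_ energy≡ΣΣflow (trans energy≡ΣΣflow (sumFin-comm flow)) ⟩
    sumFin (λ k → sumFin (flow k)) + sumFin (λ k → sumFin (λ m → flow m k))
      ≡⟨ ≡.sym (sumFin-+ {n} _ _) ⟩
    sumFin (λ k → sumFin (flow k) + sumFin (λ m → flow m k))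
      ≡⟨ sumFin-cong (λ k → ≡.sym (sumFin-+ (flow k) (λ m → flow m k))) ⟩
    sumFin (λ k → sumFin (λ m → flow k m + flow m k))
      ≡⟨ sumFin-cong (λ k → sumFin-cong (flow+flow≡edgeSquare k)) ⟩
    sumFin (λ k → sumFin (λ m → edgeSquare x k m))
      ∎
    where
    open ≡-Reasoning
    flow : Fin n → Fin n → ℚ
    flow k m = if adj G k m then x k * (x k - x m) else 0ℚ

    energy≡ΣΣflow : energy x ≡ sumFin (λ k → sumFin (flow k))
    energy≡ΣΣflow = sumFin-cong (λ k → trans (≡.sym (sumFin-*ˡ {n} (x k) _)) (sumFin-cong (term k)))
      where
      term : ∀ k m → x k * (if adj G k m then x k - x m else 0ℚ) ≡ flow k m
      term k m with adj G k m
      ... | true  = refl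
      ... | false = ℚ.*-zeroʳ (x k)

    flow+flow≡edgeSquare : ∀ k m → flow k m + flow m k ≡ edgeSquare x k m
    flow+flow≡edgeSquare k m rewrite Graph.sym G m k with adj G k m
    ... | true  = solve 2 (λ a b → a :* (a :- b) :+ b :* (b :- a) := (a :- b) :* (a :- b)) refl (x k) (x m)
    ... | false = refl

  0≤edgeSquare : ∀ x k m → 0ℚ ≤ℚ edgeSquare x k m
  0≤edgeSquare x k m with adj G k m
  ... | true  = 0≤p*p (x k - x m)
  ... | false = ℚ.≤-refl

  energy-nonNeg : ∀ x → 0ℚ ≤ℚ energy x
  energy-nonNeg x = 0≤p+p⇒0≤p (energy x)
    (subst (0ℚ ≤ℚ_) (≡.sym (energy+energy≡sum-edgeSquare x))
      (sumFin-nonNeg (λ k → sumFin-nonNeg (0≤edgeSquare x k))))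

  energy≡0⇒edge-constant : ∀ x → energy x ≡ 0ℚ → ∀ {k m} → adj G k m ≡ true → x k ≡ x m
  energy≡0⇒edge-constant x energy≡0 {k} {m} k~m =
    x∙y⁻¹≈ε⇒x≈y (x k) (x m) (p*p≡0⇒p≡0 (x k - x m) (subst edgeSquare≡0 k~m square≡0))
    where
    edgeSquare≡0 : Bool → Set
    edgeSquare≡0 b = (if b then (x k - x m) * (x k - x m) else 0ℚ) ≡ 0ℚ
    squares≡0 : sumFin (λ k → sumFin (λ m → edgeSquare x k m)) ≡ 0ℚ
    squares≡0 = trans (≡.sym (energy+energy≡sum-edgeSquare x)) (cong₂ _+_ energy≡0 energy≡0)
    square≡0 : edgeSquare x k m ≡ 0ℚ
    square≡0 = sumFin-nonNeg-≡0 (0≤edgeSquare x k)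
      (sumFin-nonNeg-≡0 (λ k → sumFin-nonNeg (0≤edgeSquare x k)) squares≡0 k) m

  energy≡0⇒constant : Connected G → ∀ x → energy x ≡ 0ℚ → ∀ a b → x a ≡ x b
  energy≡0⇒constant connected x energy≡0 a b =
    walk-preserves x (energy≡0⇒edge-constant x energy≡0) (connected a b)

module _ {G : Graph n} where
  open Dirichlet G

  potential-annihilated⇒constant : Connected G → (x : Fin n → ℚ) →
    (∀ k → x k * laplacian G x k ≡ 0ℚ) → ∀ a b → x a ≡ x b
  potential-annihilated⇒constant connected x annihilated =
    energy≡0⇒constant connected x (sumFin-zero annihilated)

  resistance≡energy : ∀ {i j r} (ω : IsResistanceDistance G i j r) → energy (proj₁ ω) ≡ r
  resistance≡energy {i} {j} {r} (x , Lx≡eᵢ-eⱼ , xᵢ-xⱼ≡r) = begin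
    sumFin (λ k → x k * laplacian G x k)
      ≡⟨ sumFin-cong (λ k → cong (x k *_) (Lx≡eᵢ-eⱼ k)) ⟩
    sumFin (λ k → x k * (indicator i k - indicator j k))
      ≡⟨ sumFin-cong (λ k → solve 3 (λ a b c → a :* (b :- c) := a :* b :- a :* c) refl
                                      (x k) (indicator i k) (indicator j k)) ⟩
    sumFin (λ k → x k * indicator i k - x k * indicator j k)
      ≡⟨ sumFin-- (λ k → x k * indicator i k) (λ k → x k * indicator j k) ⟩
    sumFin (λ k → x k * indicator i k) - sumFin (λ k → x k * indicator j k)
      ≡⟨ cong₂ _-_ (sumFin-indicator x i) (sumFin-indicator x j) ⟩
    x i - x j
      ≡⟨ xᵢ-xⱼ≡r ⟩
    r ∎
    where open ≡-Reasoning

  resistance-nonNeg : ∀ {i j r} → IsResistanceDistance G i j r → 0ℚ ≤ℚ r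
  resistance-nonNeg ω = subst (0ℚ ≤ℚ_) (resistance≡energy ω) (energy-nonNeg (proj₁ ω))

  resistance-self : ∀ {i r} → IsResistanceDistance G i i r → r ≡ 0ℚ
  resistance-self (x , _ , xᵢ-xᵢ≡r) = trans (≡.sym xᵢ-xᵢ≡r) (ℚ.+-inverseʳ (x _))

  resistance-sym : ∀ {i j r} → IsResistanceDistance G i j r → IsResistanceDistance G j i r
  resistance-sym {i} {j} (x , Lx≡eᵢ-eⱼ , xᵢ-xⱼ≡r) = (λ k → - x k) , L-x≡eⱼ-eᵢ , -xⱼ+xᵢ≡r
    where
    L-x≡eⱼ-eᵢ : ∀ k → laplacian G (λ k → - x k) k ≡ indicator j k - indicator i k
    L-x≡eⱼ-eᵢ k = trans (laplacian-neg x k) (trans (cong -_ (Lx≡eᵢ-eⱼ k))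
      (solve 2 (λ a b → :- (a :- b) := b :- a) refl (indicator i k) (indicator j k)))
    -xⱼ+xᵢ≡r : (- x j) - (- x i) ≡ _
    -xⱼ+xᵢ≡r = trans (solve 2 (λ a b → (:- b) :- (:- a) := a :- b) refl (x i) (x j)) xᵢ-xⱼ≡r

  -- The difference of two potentials for the same currents is annihilated by the Laplacian.
  resistance-unique : Connected G → ∀ {i j r r′} →
    IsResistanceDistance G i j r → IsResistanceDistance G i j r′ → r ≡ r′
  resistance-unique connected {i} {j} {r} {r′} (x , Lx≡ , xᵢ-xⱼ≡r) (x′ , Lx′≡ , x′ᵢ-x′ⱼ≡r′) = begin
    r                                              ≡⟨ ≡.sym xᵢ-xⱼ≡r ⟩
    x i - x j                                      ≡⟨ solve 4 (λ a b c d → a :- b := ((a :- c) :- (b :- d)) :+ (c :- d))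
                                                        refl (x i) (x j) (x′ i) (x′ j) ⟩
    (δ i - δ j) + (x′ i - x′ j)                    ≡⟨ cong (λ t → (t - δ j) + (x′ i - x′ j)) δᵢ≡δⱼ ⟩
    (δ j - δ j) + (x′ i - x′ j)                    ≡⟨ cong (_+ (x′ i - x′ j)) (ℚ.+-inverseʳ (δ j)) ⟩
    0ℚ + (x′ i - x′ j)                             ≡⟨ trans (ℚ.+-identityˡ _) x′ᵢ-x′ⱼ≡r′ ⟩
    r′                                             ∎
    where
    open ≡-Reasoning
    δ : Fin n → ℚ
    δ k = x k - x′ k
    Lδ≡0 : ∀ k → laplacian G δ k ≡ 0ℚ
    Lδ≡0 k = trans (laplacian-- x x′ k) (trans (cong₂ _-_ (Lx≡ k) (Lx′≡ k)) (ℚ.+-inverseʳ (indicator i k - indicator j k)))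
    δᵢ≡δⱼ : δ i ≡ δ j
    δᵢ≡δⱼ = potential-annihilated⇒constant connected δ
              (λ k → trans (cong (δ k *_) (Lδ≡0 k)) (ℚ.*-zeroʳ (δ k))) i j

  -- A zero resistance forces a constant potential, whose Laplacian cannot be eᵢ − eⱼ.
  resistance-nonZero : Connected G → ∀ {i j r} → ¬ i ≡ j → IsResistanceDistance G i j r → ¬ r ≡ 0ℚ
  resistance-nonZero connected {i} {j} i≢j ω@(x , Lx≡eᵢ-eⱼ , _) r≡0 = ℚ.1≢0 (begin
    1ℚ                            ≡⟨ cong₂ _-_ (≡.sym (indicator-diag i)) (≡.sym (indicator-off i≢j)) ⟩
    indicator i i - indicator j i ≡⟨ ≡.sym (Lx≡eᵢ-eⱼ i) ⟩
    laplacian G x i               ≡⟨ sumFin-zero {n} term≡0 ⟩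
    0ℚ                            ∎)
    where
    open ≡-Reasoning
    x-constant : ∀ a b → x a ≡ x b
    x-constant = energy≡0⇒constant connected x (trans (resistance≡energy ω) r≡0)
    term≡0 : ∀ m → (if adj G i m then x i - x m else 0ℚ) ≡ 0ℚ
    term≡0 m with adj G i m
    ... | true  = trans (cong (λ t → x i - t) (x-constant m i)) (ℚ.+-inverseʳ (x i))
    ... | false = refl

onlyIf : {P : Set} → Dec P → ℚ → ℚ
onlyIf (yes _) q = q
onlyIf (no _)  _ = 0ℚ

module _ {P : Set} where

  onlyIf-yes : (P? : Dec P) → P → ∀ q → onlyIf P? q ≡ q
  onlyIf-yes (yes _) _  q = refl
  onlyIf-yes (no ¬p) p q = ⊥-elim (¬p p)

  onlyIf-no : (P? : Dec P) → ¬ P → ∀ q → onlyIf P? q ≡ 0ℚ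
  onlyIf-no (yes p) ¬p q = ⊥-elim (¬p p)
  onlyIf-no (no _)  _  q = refl

  onlyIf-+ : (P? : Dec P) → ∀ p q → onlyIf P? (p + q) ≡ onlyIf P? p + onlyIf P? q
  onlyIf-+ (yes _) p q = refl
  onlyIf-+ (no _)  p q = refl

  onlyIf-*ˡ : (P? : Dec P) → ∀ c q → onlyIf P? (c * q) ≡ c * onlyIf P? q
  onlyIf-*ˡ (yes _) c q = refl
  onlyIf-*ˡ (no _)  c q = ≡.sym (ℚ.*-zeroʳ c)

  onlyIf-1* : (P? : Dec P) → ∀ q → onlyIf P? q ≡ onlyIf P? 1ℚ * q
  onlyIf-1* (yes _) q = ≡.sym (ℚ.*-identityˡ q)
  onlyIf-1* (no _)  q = ≡.sym (ℚ.*-zeroˡ q)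

  onlyIf-nonNeg : (P? : Dec P) → ∀ {q} → 0ℚ ≤ℚ q → 0ℚ ≤ℚ onlyIf P? q
  onlyIf-nonNeg (yes _) 0≤q = 0≤q
  onlyIf-nonNeg (no _)  0≤q = ℚ.≤-refl

module _ {S : Fin n → Set} (S? : Decidable S) where

  sumOver : (Fin n → ℚ) → ℚ
  sumOver f = sumFin (λ k → onlyIf (S? k) (f k))

  size : ℚ
  size = sumOver (λ _ → 1ℚ)

  sumOver-cong : {f g : Fin n → ℚ} → (∀ {k} → S k → f k ≡ g k) → sumOver f ≡ sumOver g
  sumOver-cong {f} {g} f≗g = sumFin-cong term
    where
    term : ∀ k → onlyIf (S? k) (f k) ≡ onlyIf (S? k) (g k)
    term k with S? k
    ... | yes Sk = f≗g Sk
    ... | no _   = refl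

  sumOver-+ : (f g : Fin n → ℚ) → sumOver (λ k → f k + g k) ≡ sumOver f + sumOver g
  sumOver-+ f g = trans (sumFin-cong (λ k → onlyIf-+ (S? k) (f k) (g k))) (sumFin-+ {n} _ _)

  sumOver-*ˡ : (c : ℚ) (f : Fin n → ℚ) → sumOver (λ k → c * f k) ≡ c * sumOver f
  sumOver-*ˡ c f = trans (sumFin-cong (λ k → onlyIf-*ˡ (S? k) c (f k))) (sumFin-*ˡ {n} c _)

  sumOver-const : (c : ℚ) → sumOver (λ _ → c) ≡ size * c
  sumOver-const c = trans (sumFin-cong (λ k → onlyIf-1* (S? k) c)) (sumFin-*ʳ {n} c _)

  sumOver-nonNeg : {f : Fin n → ℚ} → (∀ k → 0ℚ ≤ℚ f k) → 0ℚ ≤ℚ sumOver f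
  sumOver-nonNeg 0≤f = sumFin-nonNeg (λ k → onlyIf-nonNeg (S? k) (0≤f k))

  sumOver-nonNeg-≡0 : {f : Fin n → ℚ} → (∀ k → 0ℚ ≤ℚ f k) → sumOver f ≡ 0ℚ → ∀ {k} → S k → f k ≡ 0ℚ
  sumOver-nonNeg-≡0 {f} 0≤f Σf≡0 {k} Sk =
    trans (≡.sym (onlyIf-yes (S? k) Sk (f k)))
          (sumFin-nonNeg-≡0 (λ k → onlyIf-nonNeg (S? k) (0≤f k)) Σf≡0 k)

ClosedUpTo : Graph n → Fin n → (Fin n → Set) → Set
ClosedUpTo G v S = ∀ {k m} → S k → adj G k m ≡ true → S m ⊎ m ≡ v

record Separation (G : Graph n) (v : Fin n) : Set₁ where
  field
    A B        : Fin n → Set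
    A?         : Decidable A
    B?         : Decidable B
    A-closed   : ClosedUpTo G v A
    B-closed   : ClosedUpTo G v B
    v∉A        : ¬ A v
    v∉B        : ¬ B v
    disjoint   : ∀ {k} → A k → ¬ B k
    exhaustive : ∀ k → ¬ A k → ¬ B k → k ≡ v

  A≢v : ∀ {k} → A k → ¬ k ≡ v
  A≢v Ak refl = v∉A Ak

  B≢v : ∀ {k} → B k → ¬ k ≡ v
  B≢v Bk refl = v∉B Bk

  sumFin-partition : (f : Fin n → ℚ) → sumFin f ≡ sumOver A? f + f v + sumOver B? f
  sumFin-partition f = trans (sumFin-cong term)
    (trans (sumFin-+ {n} _ _) (cong (_+ sumOver B? f) (trans (sumFin-+ {n} _ _)
      (cong (sumOver A? f +_) (sumFin-indicator f v)))))
    where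
    term : ∀ k → f k ≡ onlyIf (A? k) (f k) + f k * indicator v k + onlyIf (B? k) (f k)
    term k with A? k | B? k
    ... | yes Ak | yes Bk = ⊥-elim (disjoint Ak Bk)
    ... | yes Ak | no _   rewrite indicator-off (A≢v Ak) =
      solve 1 (λ x → x := x :+ x :* con 0ℚ :+ con 0ℚ) refl (f k)
    ... | no _   | yes Bk rewrite indicator-off (B≢v Bk) =
      solve 1 (λ x → x := con 0ℚ :+ x :* con 0ℚ :+ x) refl (f k)
    ... | no ¬Ak | no ¬Bk rewrite exhaustive k ¬Ak ¬Bk | indicator-diag v =
      solve 1 (λ x → x := con 0ℚ :+ x :* con 1ℚ :+ con 0ℚ) refl (f v)

swap : {G : Graph n} {v : Fin n} → Separation G v → Separation G v
swap sep = record
  { A = B ; B = A ; A? = B? ; B? = A? ; A-closed = B-closed ; B-closed = A-closed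
  ; v∉A = v∉B ; v∉B = v∉A ; disjoint = λ Bk Ak → disjoint Ak Bk
  ; exhaustive = λ k ¬Bk ¬Ak → exhaustive k ¬Ak ¬Bk }
  where open Separation sep

module _ {G : Graph n} (connected : Connected G) where
  open Dirichlet G

  -- Subtracting y v and cutting off outside S leaves a potential with the same Laplacian on S.
  harmonic-on-closed⇒constant : ∀ {v} {S : Fin n → Set} (S? : Decidable S) → ClosedUpTo G v S → ¬ S v →
    (y : Fin n → ℚ) → (∀ {k} → S k → laplacian G y k ≡ 0ℚ) → ∀ {q} → S q → y q ≡ y v
  harmonic-on-closed⇒constant {v} {S} S? S-closed v∉S y y-harmonic {q} Sq = x∙y⁻¹≈ε⇒x≈y (y q) (y v) (begin
    y q - y v ≡⟨ ≡.sym (onlyIf-yes (S? q) Sq _) ⟩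
    d q       ≡⟨ potential-annihilated⇒constant connected d annihilated q v ⟩
    d v       ≡⟨ onlyIf-no (S? v) v∉S _ ⟩
    0ℚ        ∎)
    where
    open ≡-Reasoning
    d : Fin n → ℚ
    d k = onlyIf (S? k) (y k - y v)

    Ld≡Ly : ∀ {k} → S k → laplacian G d k ≡ laplacian G y k
    Ld≡Ly {k} Sk = sumFin-cong term
      where
      term : ∀ m → (if adj G k m then d k - d m else 0ℚ) ≡ (if adj G k m then y k - y m else 0ℚ)
      term m with adj G k m in k~m
      ... | false = refl
      ... | true with S-closed Sk k~m
      ...   | inj₁ Sm = trans (cong₂ _-_ (onlyIf-yes (S? k) Sk _) (onlyIf-yes (S? m) Sm _))
                          (solve 3 (λ a b c → (a :- c) :- (b :- c) := a :- b) refl (y k) (y m) (y v))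
      ...   | inj₂ refl = trans (cong₂ _-_ (onlyIf-yes (S? k) Sk _) (onlyIf-no (S? v) v∉S _))
                          (ℚ.+-identityʳ (y k - y v))

    annihilated : ∀ k → d k * laplacian G d k ≡ 0ℚ
    annihilated k = by-membership (S? k)
      where
      by-membership : Dec (S k) → d k * laplacian G d k ≡ 0ℚ
      by-membership (yes Sk) = trans (cong (d k *_) (trans (Ld≡Ly Sk) (y-harmonic Sk))) (ℚ.*-zeroʳ (d k))
      by-membership (no ¬Sk) = trans (cong (_* laplacian G d k) (onlyIf-no (S? k) ¬Sk _)) (ℚ.*-zeroˡ (laplacian G d k))

  -- Series law: the potentials of the two halves are constant across the cut vertex, so they add.
  resistance-series : ∀ {v} (sep : Separation G v) → ∀ {i j r s} → Separation.A sep i → Separation.B sep j →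
    IsResistanceDistance G i v r → IsResistanceDistance G v j s → IsResistanceDistance G i j (r + s)
  resistance-series {v} sep {i} {j} {r} {s} Ai Bj (y , Ly≡ , yᵢ-yᵥ≡r) (z , Lz≡ , zᵥ-zⱼ≡s) =
    (λ k → y k + z k) , L[y+z]≡ , y+z-difference
    where
    open Separation sep
    L[y+z]≡ : ∀ k → laplacian G (λ k → y k + z k) k ≡ indicator i k - indicator j k
    L[y+z]≡ k = trans (laplacian-+ y z k) (trans (cong₂ _+_ (Ly≡ k) (Lz≡ k))
      (solve 3 (λ a b c → (a :- b) :+ (b :- c) := a :- c) refl (indicator i k) (indicator v k) (indicator j k)))

    harmonic-off : ∀ {a b k} → ¬ k ≡ a → ¬ k ≡ b → indicator a k - indicator b k ≡ 0ℚ
    harmonic-off k≢a k≢b = trans (cong₂ _-_ (indicator-off k≢a) (indicator-off k≢b)) (ℚ.+-inverseʳ 0ℚ)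

    yⱼ≡yᵥ : y j ≡ y v
    yⱼ≡yᵥ = harmonic-on-closed⇒constant B? B-closed v∉B y
      (λ {k} Bk → trans (Ly≡ k) (harmonic-off (λ { refl → disjoint Ai Bk }) (B≢v Bk))) Bj

    zᵢ≡zᵥ : z i ≡ z v
    zᵢ≡zᵥ = harmonic-on-closed⇒constant A? A-closed v∉A z
      (λ {k} Ak → trans (Lz≡ k) (harmonic-off (A≢v Ak) (λ { refl → disjoint Ak Bj }))) Ai

    y+z-difference : (y i + z i) - (y j + z j) ≡ r + s
    y+z-difference = begin
      (y i + z i) - (y j + z j) ≡⟨ cong₂ (λ a b → (y i + a) - (b + z j)) zᵢ≡zᵥ yⱼ≡yᵥ ⟩
      (y i + z v) - (y v + z j) ≡⟨ solve 4 (λ a b c d → (a :+ b) :- (c :+ d) := (a :- c) :+ (b :- d))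
                                     refl (y i) (z v) (y v) (z j) ⟩
      (y i - y v) + (z v - z j) ≡⟨ cong₂ _+_ yᵢ-yᵥ≡r zᵥ-zⱼ≡s ⟩
      r + s                     ∎
      where open ≡-Reasoning

reachability-separation : {G : Graph n} {v a : Fin n} →
  Decidable (WalkIn G (λ u → ¬ u ≡ v) a) → Separation G v
reachability-separation {G = G} {v} {a} reachable? = record
  { A = Reachable ; B = Unreachable ; A? = reachable? ; B? = λ k → ¬? (reachable? k) ×-dec ¬? (k ≟ v)
  ; A-closed = A-closed ; B-closed = B-closed
  ; v∉A = λ walk → walk-end walk refl
  ; v∉B = λ (_ , v≢v) → v≢v refl
  ; disjoint = λ walk (unreachable , _) → unreachable walk
  ; exhaustive = λ k ¬Ak ¬Bk → decidable-stable (k ≟ v) (λ k≢v → ¬Bk (¬Ak , k≢v))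
  }
  where
  Reachable Unreachable : Fin _ → Set
  Reachable = WalkIn G (λ u → ¬ u ≡ v) a
  Unreachable k = ¬ Reachable k × ¬ k ≡ v

  A-closed : ClosedUpTo G v Reachable
  A-closed {k} {m} walk k~m with m ≟ v
  ... | yes m≡v = inj₂ m≡v
  ... | no  m≢v = inj₁ (walk-snoc walk k~m m≢v)

  B-closed : ClosedUpTo G v Unreachable
  B-closed {k} {m} (unreachable , k≢v) k~m with m ≟ v
  ... | yes m≡v = inj₂ m≡v
  ... | no  m≢v = inj₁ ((λ walk → unreachable (walk-snoc walk (trans (Graph.sym G m k) k~m) k≢v)) , m≢v)

t+s+m*s≡l*s⇒s≡0 : ∀ {t s l m} → 0ℚ ≤ℚ t → 0ℚ ≤ℚ s → l ≤ℚ m → t + s + m * s ≡ l * s → s ≡ 0ℚ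
t+s+m*s≡l*s⇒s≡0 {t} {s} {l} {m} 0≤t 0≤s l≤m balance = ℚ.≤-antisym s≤0 0≤s
  where
  open ℚ.≤-Reasoning
  s≤0 : s ≤ℚ 0ℚ
  s≤0 = begin
    s                          ≡⟨ ≡.sym (ℚ.+-identityˡ s) ⟩
    0ℚ + s                     ≤⟨ ℚ.+-monoˡ-≤ s 0≤t ⟩
    t + s                      ≡⟨ solve 3 (λ t s m → t :+ s := (t :+ s :+ m :* s) :- m :* s) refl t s m ⟩
    (t + s + m * s) - m * s    ≡⟨ cong (_- m * s) balance ⟩
    l * s - m * s              ≤⟨ ℚ.+-monoˡ-≤ (- (m * s)) (ℚ.*-monoʳ-≤-nonNeg s {{nonNegative 0≤s}} l≤m) ⟩
    m * s - m * s              ≡⟨ ℚ.+-inverseʳ (m * s) ⟩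
    0ℚ                         ∎

module _ {G : Graph n} (connected : Connected G) {R : Fin n → Fin n → ℚ}
         (R-resistance : ∀ i j → IsResistanceDistance G i j (R i j)) where

  R-sym : ∀ i j → R i j ≡ R j i
  R-sym i j = resistance-unique connected (R-resistance i j) (resistance-sym {G = G} (R-resistance j i))

  R-nonNeg : ∀ i j → 0ℚ ≤ℚ R i j
  R-nonNeg i j = resistance-nonNeg {G = G} (R-resistance i j)

  R-across : ∀ {v} (sep : Separation G v) → let open Separation sep in
    ∀ {i j} → A i → B j → R i j ≡ R i v + R v j
  R-across {v} sep {i} {j} Ai Bj = resistance-unique connected (R-resistance i j)
    (resistance-series connected sep Ai Bj (R-resistance i v) (R-resistance v j))

  module _ (equal-row-sums : ∀ i j → sumFin (R i) ≡ sumFin (R j)) where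

    module _ {v : Fin n} (sep : Separation G v) where
      open Separation sep
      open ≡-Reasoning

      private
        X : Fin n → ℚ
        X i = sumOver A? (R i)

        s T : ℚ
        s = X v
        T = sumOver A? X

        through-v : ∀ {i} → A i → sumOver B? (R i) ≡ size B? * R i v + sumOver B? (R v)
        through-v {i} Ai = begin
          sumOver B? (R i)                            ≡⟨ sumOver-cong B? (R-across sep Ai) ⟩
          sumOver B? (λ j → R i v + R v j)           ≡⟨ sumOver-+ B? (λ _ → R i v) (R v) ⟩
          sumOver B? (λ _ → R i v) + sumOver B? (R v) ≡⟨ cong (_+ sumOver B? (R v)) (sumOver-const B? (R i v)) ⟩
          size B? * R i v + sumOver B? (R v)         ∎

        row-balance : ∀ {i} → A i → X i + R i v + size B? * R i v ≡ s
        row-balance {i} Ai = ∙-cancelʳ (sumOver B? (R v)) _ _ (begin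
          X i + R i v + size B? * R i v + sumOver B? (R v)   ≡⟨ ℚ.+-assoc (X i + R i v) _ _ ⟩
          X i + R i v + (size B? * R i v + sumOver B? (R v)) ≡⟨ cong (X i + R i v +_) (≡.sym (through-v Ai)) ⟩
          X i + R i v + sumOver B? (R i)                     ≡⟨ ≡.sym (sumFin-partition (R i)) ⟩
          sumFin (R i)                                       ≡⟨ equal-row-sums i v ⟩
          sumFin (R v)                                       ≡⟨ sumFin-partition (R v) ⟩
          X v + R v v + sumOver B? (R v)                     ≡⟨ cong (λ r → X v + r + sumOver B? (R v))
                                                                  (resistance-self {G = G} (R-resistance v v)) ⟩
          X v + 0ℚ + sumOver B? (R v)                        ≡⟨ cong (_+ sumOver B? (R v)) (ℚ.+-identityʳ (X v)) ⟩
          s + sumOver B? (R v)                               ∎)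

        balance : T + s + size B? * s ≡ size A? * s
        balance = begin
          T + s + size B? * s
            ≡⟨ cong (λ u → T + u + size B? * u) (≡.sym (sumOver-cong A? (λ {i} _ → R-sym i v))) ⟩
          T + Σ[R·v] + size B? * Σ[R·v]
            ≡⟨ cong (T + Σ[R·v] +_) (≡.sym (sumOver-*ˡ A? (size B?) (λ i → R i v))) ⟩
          T + Σ[R·v] + sumOver A? (λ i → size B? * R i v)
            ≡⟨ cong (_+ sumOver A? (λ i → size B? * R i v)) (≡.sym (sumOver-+ A? X (λ i → R i v))) ⟩
          sumOver A? (λ i → X i + R i v) + sumOver A? (λ i → size B? * R i v)
            ≡⟨ ≡.sym (sumOver-+ A? (λ i → X i + R i v) (λ i → size B? * R i v)) ⟩
          sumOver A? (λ i → X i + R i v + size B? * R i v)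
            ≡⟨ sumOver-cong A? row-balance ⟩
          sumOver A? (λ _ → s)
            ≡⟨ sumOver-const A? s ⟩
          size A? * s
            ∎
          where
          Σ[R·v] : ℚ
          Σ[R·v] = sumOver A? (λ i → R i v)

      inhabited-side-larger : ∀ {a} → A a → ¬ size A? ≤ℚ size B?
      inhabited-side-larger {a} Aa |A|≤|B| =
        resistance-nonZero connected (A≢v Aa ∘ ≡.sym) (R-resistance v a)
          (sumOver-nonNeg-≡0 A? (R-nonNeg v) s≡0 Aa)
        where
        s≡0 : s ≡ 0ℚ
        s≡0 = t+s+m*s≡l*s⇒s≡0 (sumOver-nonNeg A? (λ i → sumOver-nonNeg A? (R-nonNeg i)))
                                (sumOver-nonNeg A? (R-nonNeg v)) |A|≤|B| balance

    no-separation-with-inhabited-sides : ∀ {v} (sep : Separation G v) → let open Separation sep in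
      ∀ {a b} → A a → B b → ⊥
    no-separation-with-inhabited-sides sep {a} {b} Aa Bb
      with ℚ.≤-total (size (Separation.A? sep)) (size (Separation.B? sep))
    ... | inj₁ |A|≤|B| = inhabited-side-larger sep Aa |A|≤|B|
    ... | inj₂ |B|≤|A| = inhabited-side-larger (swap sep) Bb |B|≤|A|

    reachability-decidable⇒connected-without : ∀ {v} →
      (∀ a → Decidable (WalkIn G (λ u → ¬ u ≡ v) a)) → ConnectedWithout G v
    reachability-decidable⇒connected-without reachable? a b a≢v b≢v with reachable? a b
    ... | yes walk        = walk
    ... | no  unreachable = ⊥-elim (no-separation-with-inhabited-sides
                              (reachability-separation (reachable? a)) (here a≢v) (unreachable , b≢v))

¬¬-∀-Fin : {P : Fin n → Set} → (∀ k → ¬ ¬ P k) → ¬ ¬ (∀ k → P k)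
¬¬-∀-Fin {zero}  ¬¬P ¬∀P = ¬∀P (λ ())
¬¬-∀-Fin {suc n} ¬¬P ¬∀P = ¬¬P zero (λ P₀ → ¬¬-∀-Fin (λ k → ¬¬P (suc k))
  (λ Pₛ → ¬∀P (λ { zero → P₀ ; (suc k) → Pₛ k })))

constant-solution⇒equal-row-sums : (R : Fin n → Fin n → ℚ) (κ : Fin n → ℚ) →
  (∀ i → sumFin (λ j → R i j * κ j) ≡ 1ℚ) → (∀ i j → κ i ≡ κ j) →
  ∀ i j → sumFin (R i) ≡ sumFin (R j)
constant-solution⇒equal-row-sums R κ Rκ≡1 κ-constant i j = begin
  ρ i               ≡⟨ ≡.sym (ℚ.*-identityʳ (ρ i)) ⟩
  ρ i * 1ℚ          ≡⟨ cong (ρ i *_) (trans (≡.sym (ρκ≡1 j)) (ℚ.*-comm (ρ j) (κ i))) ⟩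
  ρ i * (κ i * ρ j) ≡⟨ ≡.sym (ℚ.*-assoc (ρ i) (κ i) (ρ j)) ⟩
  ρ i * κ i * ρ j   ≡⟨ cong (_* ρ j) (ρκ≡1 i) ⟩
  1ℚ * ρ j          ≡⟨ ℚ.*-identityˡ (ρ j) ⟩
  ρ j               ∎
  where
  open ≡-Reasoning
  ρ : Fin _ → ℚ
  ρ k = sumFin (R k)
  ρκ≡1 : ∀ k → ρ k * κ i ≡ 1ℚ
  ρκ≡1 k = trans (≡.sym (sumFin-*ʳ (κ i) (R k)))
             (trans (sumFin-cong (λ l → cong (R k l *_) (κ-constant i l))) (Rκ≡1 k))

theorem2p5 : (n : ℕ) (G : Graph n) → 3 ≤ n → Connected G →
    (R : Fin n → Fin n → ℚ) → (∀ i j → IsResistanceDistance G i j (R i j)) →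
    (κ : Fin n → ℚ) → (∀ i → sumFin (λ j → R i j * κ j) ≡ 1ℚ) →
    (∀ i j → κ i ≡ κ j) → TwoConnected G
theorem2p5 n G 3≤n connected R R-resistance κ Rκ≡1 κ-constant = connected , 3≤n , no-cut-vertex
  where
  equal-row-sums : ∀ i j → sumFin (R i) ≡ sumFin (R j)
  equal-row-sums = constant-solution⇒equal-row-sums R κ Rκ≡1 κ-constant

  -- The goal is a negation, so reachability in G − v may be decided under ¬¬.
  no-cut-vertex : ∀ v → ¬ IsCutVertex G v
  no-cut-vertex v cut =
    ¬¬-∀-Fin (λ a → ¬¬-∀-Fin (λ k → ¬¬-excluded-middle))
      (cut ∘ reachability-decidable⇒connected-without connected R-resistance equal-row-sums)
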